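{- Let $G$ and $H$ be Left dead-ends, and assume that no subposition of $G$ nor of $H$ has any dominated option, i.e., no subposition $K$ has two distinct Right options $K^{R_1},K^{R_2}$ with $K^{R_1}\geq_{\mathcal{M}}K^{R_2}$. If $G\equiv_{\mathcal{M}}H$, then $G\cong H$.
   Context: All games are finite partizan games $G=\{\mathscr{G}^L \mid \mathscr{G}^R\}$ with finite sets of Left and Right options; $G^L,G^R$ denote typical options; subpositions include $G$ itself. $G\cong H$ means identical game trees; $0=\{\cdot\mid\cdot\}$. Disjunctive sum $G+H=\{G^L+H,G+H^L\mid G^R+H,G+H^R\}$. Misère play (a player unable to move wins); outcomes: $o^L(G)=\mathscr{L}$ iff $G$ has no Left option or some $o^R(G^L)=\mathscr{L}$ (else $\mathscr{R}$); $o^R(G)=\mathscr{R}$ iff $G$ has no Right option or some $o^L(G^R)=\mathscr{R}$ (else $\mathscr{L}$); $o(G)\in\{\mathscr{L},\mathscr{N},\mathscr{P},\mathscr{R}\}$ corresponds to $(o^L,o^R)=(\mathscr{L},\mathscr{L}),(\mathscr{L},\mathscr{R}),(\mathscr{R},\mathscr{L}),(\mathscr{R},\mathscr{R})$, ordered $\mathscr{L}>\mathscr{N}>\mathscr{R}$, $\mathscr{L}>\mathscr{P}>\mathscr{R}$. $\mathcal{M}$ is the set of all games; $G\geq_{\mathcal{M}}H$ means $o(G+X)\geq o(H+X)$ for all games $X$, and $G\equiv_{\mathcal{M}}H$ means $G\geq_{\mathcal{M}}H$ and $H\geq_{\mathcal{M}}G$. (Among Left dead-ends this relation coincides with the analogous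 relation modulo any universe.) A Left dead-end is a game every subposition of which has no Left option. -}

module Defs where

open import Data.List using (List; []; _∷_; _++_)
open import Data.List.Relation.Unary.All using (All)
open import Data.List.Relation.Unary.Any using (Any)
open import Data.List.Membership.Propositional using (_∈_)
open import Data.Bool using (Bool; true; false; _∨_; _∧_; not)
open import Relation.Nullary using (¬_)
open import Data.Product using (_×_)

-- A finite partizan game {Left options | Right options}.
-- Options are given as finite lists; the order/multiplicity of list
-- entries is irrelevant for _≅_ (identity of game trees, see below).
data Game : Set where
  ⟨_∣_⟩ : List Game → List Game → Game

leftOpts rightOpts : Game → List Game
leftOpts  ⟨ Ls ∣ _ ⟩ = Ls
rightOpts ⟨ _ ∣ Rs ⟩ = Rs

data _≅_ : Game → Game → Set where
  iso : ∀ {GL GR HL HR} →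
        All (λ g → Any (λ h → g ≅ h) HL) GL →
        All (λ h → Any (λ g → g ≅ h) GL) HL →
        All (λ g → Any (λ h → g ≅ h) HR) GR →
        All (λ h → Any (λ g → g ≅ h) GR) HR →
        ⟨ GL ∣ GR ⟩ ≅ ⟨ HL ∣ HR ⟩

mutual
  _+_ : Game → Game → Game
  g@(⟨ GL ∣ GR ⟩) + h@(⟨ HL ∣ HR ⟩) =
    ⟨ addL GL h ++ addR g HL ∣ addL GR h ++ addR g HR ⟩

  addL : List Game → Game → List Game
  addL []       h = []
  addL (g ∷ gs) h = (g + h) ∷ addL gs h

  addR : Game → List Game → List Game
  addR g []       = []
  addR g (h ∷ hs) = (g + h) ∷ addR g hs

-- Misère outcomes.
-- leftWinsL G  : o^L(G) = 𝓛  (Left moving first wins)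
-- leftWinsR G  : o^R(G) = 𝓛  (Left wins when Right moves first),
--                i.e. o^R(G) ≠ 𝓡.
mutual
  leftWinsL : Game → Bool
  leftWinsL ⟨ Ls ∣ _ ⟩ = noneOrSomeR Ls

  -- o^L(G)=𝓛 iff no Left option, or some o^R(G^L)=𝓛
  noneOrSomeR : List Game → Bool
  noneOrSomeR []       = true
  noneOrSomeR (g ∷ gs) = leftWinsR g ∨ anyR gs

  anyR : List Game → Bool
  anyR []       = false
  anyR (g ∷ gs) = leftWinsR g ∨ anyR gs

  -- o^R(G)=𝓡 iff no Right option, or some o^L(G^R)=𝓡
  leftWinsR : Game → Bool
  leftWinsR ⟨ _ ∣ Rs ⟩ = not (noneOrSomeNotL Rs)

  noneOrSomeNotL : List Game → Bool
  noneOrSomeNotL []       = true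
  noneOrSomeNotL (g ∷ gs) = not (leftWinsL g) ∨ anyNotL gs

  anyNotL : List Game → Bool
  anyNotL []       = false
  anyNotL (g ∷ gs) = not (leftWinsL g) ∨ anyNotL gs

data Outcome : Set where
  𝓛 𝓝 𝓟 𝓡 : Outcome

outcomeOf : Bool → Bool → Outcome
outcomeOf true  true  = 𝓛
outcomeOf true  false = 𝓝
outcomeOf false true  = 𝓟
outcomeOf false false = 𝓡

outcome : Game → Outcome
outcome G = outcomeOf (leftWinsL G) (leftWinsR G)

data _≥o_ : Outcome → Outcome → Set where
  refl≥ : ∀ {o} → o ≥o o
  L≥N : 𝓛 ≥o 𝓝
  L≥P : 𝓛 ≥o 𝓟
  L≥R : 𝓛 ≥o 𝓡
  N≥R : 𝓝 ≥o 𝓡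
  P≥R : 𝓟 ≥o 𝓡

_≥M_ : Game → Game → Set
G ≥M H = ∀ X → outcome (G + X) ≥o outcome (H + X)

_≡M_ : Game → Game → Set
G ≡M H = (G ≥M H) × (H ≥M G)

data LeftDeadEnd : Game → Set where
  lde : ∀ {Rs} → All LeftDeadEnd Rs → LeftDeadEnd ⟨ [] ∣ Rs ⟩

data NoDominated : Game → Set where
  nd : ∀ {Ls Rs} → All NoDominated Ls → All NoDominated Rs →
       (∀ {a b} → a ∈ Rs → b ∈ Rs → ¬ (a ≅ b) → ¬ (a ≥M b)) →
       NoDominated ⟨ Ls ∣ Rs ⟩

-- For Left dead-ends, G ≥ H forces every Right option K of G to dominate some Right option of H.
-- Otherwise pick, for each Right option h of H, a game T_h that Right (moving first) wins against K
-- but loses against h, and let X = {{· | K°}, T_h, … | 0} with K° an adjoint of K. Right, moving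
-- first in G + X, moves to K + X, after which every Left move loses (K + {· | K°} is answered by
-- K + K°); in H + X every Right move loses, since h + X is answered by h + T_h and H + 0 leaves
-- Left without a move. So G ≥ H fails. When G ≡ H this gives K ≥ h ≥ K′ for Right options K, K′
-- of G, hence K ≅ K′ as G has no dominated options, so K ≡ h and induction yields G ≅ H.
-- Since ≥ quantifies over all games, the matching is only obtained under double negation, which
-- the decidability of ≅ removes at the end.

module Submission where

open import Defs
open import Data.Bool using (Bool; true; false; _∨_; not; T; _≤_; f≤t; b≤b)
open import Data.Bool.Properties using (≤-minimum; _≤?_; not-injective; not-involutive; ∨-zeroʳ)
open import Data.Bool.ListAction using (any)
open import Data.List using (List; []; _∷_; _++_; map; null)
open import Data.List.Relation.Unary.All as All using (All; []; _∷_)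
open import Data.List.Relation.Unary.Any as Any using (Any; here; there)
open import Data.List.Relation.Unary.Any.Properties using (any⁺; any⁻)
open import Data.List.Membership.Propositional using (_∈_; find; lose)
open import Data.List.Membership.Propositional.Properties
  using (∈-++⁺ˡ; ∈-++⁺ʳ; ∈-++⁻; ∈-map⁺; ∈-map⁻)
open import Data.Empty using (⊥-elim)
open import Data.Product using (_×_; _,_; proj₁; proj₂; ∃; ∃-syntax; swap; uncurry)
open import Data.Sum using (_⊎_; inj₁; inj₂)
open import Data.Unit using (tt)
open import Effect.Monad using (RawMonad)
open import Function using (_∘_; flip)
open import Induction.WellFounded using (WellFounded; Acc; acc)
open import Level using (0ℓ)
import Induction.WellFounded as WF
import Relation.Binary.Construct.On as On
open import Relation.Binary.PropositionalEquality
  using (_≡_; refl; sym; trans; cong; cong₂; subst; subst₂)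
open import Relation.Nullary using (¬_; Dec; yes; no)
open import Relation.Nullary.Decidable using (map′; _×-dec_; _⊎-dec_; decidable-stable)
open import Relation.Nullary.Negation using (¬¬-Monad; ¬¬-map; contradiction)

open RawMonad (¬¬-Monad {a = 0ℓ}) using (_>>=_; pure)

private
  variable
    A B : Set
    R S : A → B → Set
    P : A → Set
    x : A
    xs : List A
    ys : List B

-- Lists related elementwise

Covers : (A → B → Set) → List A → List B → Set
Covers R xs ys = All (λ x → Any (R x) ys) xs

Matches : (A → B → Set) → List A → List B → Set
Matches R xs ys = Covers R xs ys × Covers (flip R) ys xs

Matches-map : (∀ {x y} → R x y → S x y) → Matches R xs ys → Matches S xs ys
Matches-map f (c , c′) = All.map (Any.map f) c , All.map (Any.map f) c′

Any-transport : Covers R xs ys → (∀ {x y} → R x y → P x → P y) → Any P xs → Any P ys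
Any-transport c f p with x , x∈xs , px ← find p = Any.map (λ r → f r px) (All.lookup c x∈xs)

null-cong : Matches R xs ys → null xs ≡ null ys
null-cong {xs = []}    {ys = []}    _              = refl
null-cong {xs = _ ∷ _} {ys = _ ∷ _} _              = refl
null-cong {xs = _ ∷ _} {ys = []}    (() ∷ _ , _)
null-cong {xs = []}    {ys = _ ∷ _} (_ , () ∷ _)

T-ext : ∀ {a b} → (T a → T b) → (T b → T a) → a ≡ b
T-ext {false} {false} _ _ = refl
T-ext {true}  {true}  _ _ = refl
T-ext {true}  {false} f _ = ⊥-elim (f tt)
T-ext {false} {true}  _ g = ⊥-elim (g tt)

any-cong : (f : A → Bool) → Matches (λ x y → f x ≡ f y) xs ys → any f xs ≡ any f ys
any-cong {xs = xs} {ys = ys} f (c , c′) =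
  T-ext (any⁺ f ∘ Any-transport c (subst T) ∘ any⁻ f xs)
        (any⁺ f ∘ Any-transport c′ (subst T ∘ sym) ∘ any⁻ f ys)

any-≡true : (f : A → Bool) → x ∈ xs → f x ≡ true → any f xs ≡ true
any-≡true f (here refl) e rewrite e = refl
any-≡true f (there {x = y} m) e rewrite any-≡true f m e = ∨-zeroʳ (f y)

any-≡false : (f : A → Bool) → All (λ x → f x ≡ false) xs → any f xs ≡ false
any-≡false f []       = refl
any-≡false f (e ∷ es) rewrite e = any-≡false f es

null-∈ : x ∈ xs → null xs ≡ false
null-∈ (here _)  = refl
null-∈ (there _) = refl

witnesses-matches : (ws : All (λ x → ∃ (R x)) xs) → Matches R xs (All.reduce proj₁ ws)
witnesses-matches []              = [] , []
witnesses-matches ((_ , r) ∷ ws) with c , c′ ← witnesses-matches ws =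
  here r ∷ All.map there c , here r ∷ All.map there c′

any∈? : (∀ {x} → x ∈ xs → Dec (P x)) → Dec (Any P xs)
any∈? {xs = []}    d = no λ ()
any∈? {xs = _ ∷ _} d = map′ Any.fromSum Any.toSum (d (here refl) ⊎-dec any∈? (d ∘ there))

all∈? : (∀ {x} → x ∈ xs → Dec (P x)) → Dec (All P xs)
all∈? {xs = []}    d = yes []
all∈? {xs = _ ∷ _} d = map′ (uncurry _∷_) All.uncons (d (here refl) ×-dec all∈? (d ∘ there))

¬¬-All : All (λ x → ¬ ¬ P x) xs → ¬ ¬ All P xs
¬¬-All = All.sequenceM _ ¬¬-Monad

-- Options and induction on games

data Player : Set where
  Left Right : Player

opponent : Player → Player
opponent Left  = Right
opponent Right = Left

options : Player → Game → List Game
options Left  = leftOpts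
options Right = rightOpts

infix 4 _⊏_

_⊏_ : Game → Game → Set
g ⊏ G = ∃[ p ] g ∈ options p G

mutual
  ⊏-wellFounded : WellFounded _⊏_
  ⊏-wellFounded ⟨ Ls ∣ Rs ⟩ = acc λ where
    (Left  , m) → All.lookup (options-accessible Ls) m
    (Right , m) → All.lookup (options-accessible Rs) m

  options-accessible : (gs : List Game) → All (Acc _⊏_) gs
  options-accessible []       = []
  options-accessible (g ∷ gs) = ⊏-wellFounded g ∷ options-accessible gs

game-induction : (Q : Game → Set) → (∀ G → (∀ {g} → g ⊏ G → Q g) → Q G) → ∀ G → Q G
game-induction = WF.All.wfRec ⊏-wellFounded _

addL≡map : ∀ gs X → addL gs X ≡ map (_+ X) gs
addL≡map []       X = refl
addL≡map (g ∷ gs) X = cong (g + X ∷_) (addL≡map gs X)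

addR≡map : ∀ G xs → addR G xs ≡ map (G +_) xs
addR≡map G []       = refl
addR≡map G (x ∷ xs) = cong (G + x ∷_) (addR≡map G xs)

options-+ : ∀ p G X → options p (G + X) ≡ map (_+ X) (options p G) ++ map (G +_) (options p X)
options-+ Left  ⟨ GL ∣ _ ⟩ X@(⟨ XL ∣ _ ⟩) = cong₂ _++_ (addL≡map GL X) (addR≡map _ XL)
options-+ Right ⟨ _ ∣ GR ⟩ X@(⟨ _ ∣ XR ⟩) = cong₂ _++_ (addL≡map GR X) (addR≡map _ XR)

module _ (p : Player) where

  ∈-options-+ˡ : ∀ G X {g} → g ∈ options p G → g + X ∈ options p (G + X)
  ∈-options-+ˡ G X m rewrite options-+ p G X = ∈-++⁺ˡ (∈-map⁺ (_+ X) m)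

  ∈-options-+ʳ : ∀ G X {x} → x ∈ options p X → G + x ∈ options p (G + X)
  ∈-options-+ʳ G X m rewrite options-+ p G X = ∈-++⁺ʳ _ (∈-map⁺ (G +_) m)

  ∈-options-+⁻ : ∀ G X {y} → y ∈ options p (G + X) →
                 (∃[ g ] g ∈ options p G × y ≡ g + X) ⊎ (∃[ x ] x ∈ options p X × y ≡ G + x)
  ∈-options-+⁻ G X m rewrite options-+ p G X with ∈-++⁻ (map (_+ X) (options p G)) m
  ... | inj₁ m′ = inj₁ (∈-map⁻ (_+ X) m′)
  ... | inj₂ m′ = inj₂ (∈-map⁻ (G +_) m′)

sum-induction : (Q : Game → Game → Set) →
                (∀ G X → (∀ p {g} → g ∈ options p G → Q g X) →
                         (∀ p {x} → x ∈ options p X → Q G x) → Q G X) →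
                ∀ G X → Q G X
sum-induction Q step G X =
  WF.All.wfRec (On.wellFounded (uncurry _+_) ⊏-wellFounded) _ (uncurry Q)
    (λ (G , X) ih → step G X (λ p m → ih (p , ∈-options-+ˡ p G X m))
                             (λ p m → ih (p , ∈-options-+ʳ p G X m)))
    (G , X)

-- Outcomes

winsFirst : Player → Game → Bool
winsFirst Left  = leftWinsL
winsFirst Right = not ∘ leftWinsR

anyR≡any : ∀ gs → anyR gs ≡ any (not ∘ winsFirst Right) gs
anyR≡any []       = refl
anyR≡any (g ∷ gs) = cong₂ _∨_ (sym (not-involutive (leftWinsR g))) (anyR≡any gs)

anyNotL≡any : ∀ gs → anyNotL gs ≡ any (not ∘ winsFirst Left) gs
anyNotL≡any []       = refl
anyNotL≡any (g ∷ gs) = cong (not (leftWinsL g) ∨_) (anyNotL≡any gs)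

winsFirst-options : ∀ p G →
  winsFirst p G ≡ null (options p G) ∨ any (not ∘ winsFirst (opponent p)) (options p G)
winsFirst-options Left  ⟨ []     ∣ _ ⟩ = refl
winsFirst-options Left  ⟨ g ∷ gs ∣ _ ⟩ = anyR≡any (g ∷ gs)
winsFirst-options Right ⟨ _ ∣ []     ⟩ = refl
winsFirst-options Right ⟨ _ ∣ g ∷ gs ⟩ = trans (not-involutive _) (anyNotL≡any (g ∷ gs))

module _ (p : Player) (G : Game) where

  winsFirst-move : ∀ {g} → g ∈ options p G → winsFirst (opponent p) g ≡ false →
                   winsFirst p G ≡ true
  winsFirst-move m e rewrite winsFirst-options p G =
    trans (cong (null (options p G) ∨_) (any-≡true _ m (cong not e))) (∨-zeroʳ _)

  winsFirst-stuck : ∀ {g} → g ∈ options p G →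
                    All (λ g → winsFirst (opponent p) g ≡ true) (options p G) → winsFirst p G ≡ false
  winsFirst-stuck m es rewrite winsFirst-options p G =
    cong₂ _∨_ (null-∈ m) (any-≡false _ (All.map (cong not) es))

SameWins : Game → Game → Set
SameWins G H = ∀ p → winsFirst p G ≡ winsFirst p H

winsFirst-cong : ∀ {G H} → (∀ p → Matches SameWins (options p G) (options p H)) → SameWins G H
winsFirst-cong {G} {H} m p rewrite winsFirst-options p G | winsFirst-options p H =
  cong₂ _∨_ (null-cong (m p)) (any-cong _ (Matches-map (λ s → cong not (s (opponent p))) (m p)))

≥o-trans : ∀ {o₁ o₂ o₃} → o₁ ≥o o₂ → o₂ ≥o o₃ → o₁ ≥o o₃
≥o-trans refl≥ q     = q
≥o-trans L≥N   refl≥ = L≥N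
≥o-trans L≥N   N≥R   = L≥R
≥o-trans L≥P   refl≥ = L≥P
≥o-trans L≥P   P≥R   = L≥R
≥o-trans L≥R   refl≥ = L≥R
≥o-trans N≥R   refl≥ = N≥R
≥o-trans P≥R   refl≥ = P≥R

≥M-trans : ∀ {G H K} → G ≥M H → H ≥M K → G ≥M K
≥M-trans G≥H H≥K X = ≥o-trans (G≥H X) (H≥K X)

≤⇒≥o : ∀ {a b c d} → c ≤ a → d ≤ b → outcomeOf a b ≥o outcomeOf c d
≤⇒≥o               b≤b b≤b = refl≥
≤⇒≥o {b = true}    f≤t b≤b = L≥P
≤⇒≥o {b = false}   f≤t b≤b = N≥R
≤⇒≥o {a = true}    b≤b f≤t = L≥N
≤⇒≥o {a = false}   b≤b f≤t = P≥R
≤⇒≥o               f≤t f≤t = L≥R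

≰⇒ : ∀ {a b} → ¬ a ≤ b → a ≡ true × b ≡ false
≰⇒ {false} {b}     a≰b = contradiction (≤-minimum b) a≰b
≰⇒ {true}  {true}  a≰b = contradiction b≤b a≰b
≰⇒ {true}  {false} _   = refl , refl

≥o-or-separated : ∀ G H → outcome G ≥o outcome H
                          ⊎ (winsFirst Left H ≡ true × winsFirst Left G ≡ false)
                          ⊎ (winsFirst Right G ≡ true × winsFirst Right H ≡ false)
≥o-or-separated G H with leftWinsL H ≤? leftWinsL G | leftWinsR H ≤? leftWinsR G
... | yes l | yes r = inj₁ (≤⇒≥o l r)
... | no ¬l | _     = inj₂ (inj₁ (≰⇒ ¬l))
... | yes _ | no ¬r with H-wins , G-loses ← ≰⇒ ¬r =
  inj₂ (inj₂ (cong not G-loses , cong not H-wins))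

¬≥o-rightFirst : ∀ {G H} → winsFirst Right G ≡ true → winsFirst Right H ≡ false →
                 ¬ outcome G ≥o outcome H
¬≥o-rightFirst {G} {H} G-wins H-loses =
  subst₂ (λ b d → ¬ outcomeOf (leftWinsL G) b ≥o outcomeOf (leftWinsL H) d)
         (sym (not-injective G-wins)) (sym (not-injective H-loses)) (impossible _ _)
  where
  impossible : ∀ a c → ¬ outcomeOf a false ≥o outcomeOf c true
  impossible true  true  ()
  impossible true  false ()
  impossible false true  ()
  impossible false false ()

-- Identical game trees

≅-matches : ∀ {G H} → G ≅ H → ∀ p → Matches _≅_ (options p G) (options p H)
≅-matches (iso l l′ _ _) Left  = l , l′
≅-matches (iso _ _ r r′) Right = r , r′

≅-+-sameWins : ∀ G X {H} → G ≅ H → SameWins (G + X) (H + X)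
≅-+-sameWins = sum-induction (λ G X → ∀ {H} → G ≅ H → SameWins (G + X) (H + X)) step
  where
  step : ∀ G X → (∀ p {g} → g ∈ options p G → ∀ {h} → g ≅ h → SameWins (g + X) (h + X)) →
                 (∀ p {x} → x ∈ options p X → ∀ {H} → G ≅ H → SameWins (G + x) (H + x)) →
         ∀ {H} → G ≅ H → SameWins (G + X) (H + X)
  step G X ihˡ ihʳ {H} G≅H = winsFirst-cong λ p → All.tabulate (forth p) , All.tabulate (back p)
    where
    forth : ∀ p {y} → y ∈ options p (G + X) → Any (SameWins y) (options p (H + X))
    forth p m with ∈-options-+⁻ p G X m
    ... | inj₁ (g , g∈ , refl)
        with h , h∈ , g≅h ← find (All.lookup (proj₁ (≅-matches G≅H p)) g∈) =
      lose (∈-options-+ˡ p H X h∈) (ihˡ p g∈ g≅h)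
    ... | inj₂ (x , x∈ , refl) = lose (∈-options-+ʳ p H X x∈) (ihʳ p x∈ G≅H)

    back : ∀ p {y} → y ∈ options p (H + X) → Any (flip SameWins y) (options p (G + X))
    back p m with ∈-options-+⁻ p H X m
    ... | inj₁ (h , h∈ , refl)
        with g , g∈ , g≅h ← find (All.lookup (proj₂ (≅-matches G≅H p)) h∈) =
      lose (∈-options-+ˡ p G X g∈) (ihˡ p g∈ g≅h)
    ... | inj₂ (x , x∈ , refl) = lose (∈-options-+ʳ p G X x∈) (ihʳ p x∈ G≅H)

≅⇒≡M : ∀ {G H} → G ≅ H → G ≡M H
≅⇒≡M {G} {H} G≅H = (λ X → ≡⇒≥o (same X)) , (λ X → ≡⇒≥o (sym (same X)))
  where
  same : ∀ X → outcome (G + X) ≡ outcome (H + X)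
  same X = cong₂ outcomeOf (s Left) (not-injective (s Right))
    where s = ≅-+-sameWins G X G≅H

  ≡⇒≥o : ∀ {o o′} → o ≡ o′ → o ≥o o′
  ≡⇒≥o refl = refl≥

≅-dec : ∀ G H → Dec (G ≅ H)
≅-dec = game-induction (λ G → ∀ H → Dec (G ≅ H)) step
  where
  step : ∀ G → (∀ {g} → g ⊏ G → ∀ H → Dec (g ≅ H)) → ∀ H → Dec (G ≅ H)
  step G@(⟨ _ ∣ _ ⟩) ih H@(⟨ _ ∣ _ ⟩) =
    map′ (λ ((l , l′) , (r , r′)) → iso l l′ r r′)
         (λ G≅H → ≅-matches G≅H Left , ≅-matches G≅H Right)
         (matches? Left ×-dec matches? Right)
    where
    matches? : ∀ p → Dec (Matches _≅_ (options p G) (options p H))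
    matches? p = all∈? (λ m → Any.any? (ih (p , m)) (options p H))
                 ×-dec All.all? (λ h → any∈? (λ m → ih (p , m) h)) (options p H)

-- Left dead-ends

⟨∣_⟩ : Game → Game
⟨∣ X ⟩ = ⟨ [] ∣ X ∷ [] ⟩

leftDeadEnd-+-leftWins : ∀ {D} → LeftDeadEnd D → ∀ Rs → winsFirst Left (D + ⟨ [] ∣ Rs ⟩) ≡ true
leftDeadEnd-+-leftWins (lde _) Rs = refl

-- A variant of the misère adjoint that suffices for Left dead-ends.
mutual
  adjoint : Game → Game
  adjoint ⟨ _ ∣ []     ⟩ = ⟨ ⟨ [] ∣ [] ⟩ ∷ [] ∣ [] ⟩
  adjoint ⟨ _ ∣ r ∷ rs ⟩ = ⟨ adjoints (r ∷ rs) ∣ [] ⟩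

  adjoints : List Game → List Game
  adjoints []       = []
  adjoints (r ∷ rs) = adjoint r ∷ adjoints rs

adjoints≡map : ∀ rs → adjoints rs ≡ map adjoint rs
adjoints≡map []       = refl
adjoints≡map (r ∷ rs) = cong (adjoint r ∷_) (adjoints≡map rs)

adjoint-leftLoses : ∀ D → LeftDeadEnd D → winsFirst Left (D + adjoint D) ≡ false
adjoint-leftLoses = game-induction (λ D → LeftDeadEnd D → winsFirst Left (D + adjoint D) ≡ false) step
  where
  step : ∀ D → (∀ {r} → r ⊏ D → LeftDeadEnd r → winsFirst Left (r + adjoint r) ≡ false) →
         LeftDeadEnd D → winsFirst Left (D + adjoint D) ≡ false
  step _ ih (lde {[]} _) = refl
  step D@(⟨ _ ∣ r ∷ rs ⟩) ih (lde dRs) =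
    winsFirst-stuck Left (D + adjoint D) (∈-options-+ʳ Left D (adjoint D) (here refl))
                    (All.tabulate rightWins)
    where
    rightWins : ∀ {y} → y ∈ options Left (D + adjoint D) → winsFirst Right y ≡ true
    rightWins m with ∈-options-+⁻ Left D (adjoint D) m
    ... | inj₁ (_ , () , _)
    ... | inj₂ (x , x∈ , refl)
        with r′ , r′∈ , refl ← ∈-map⁻ adjoint (subst (x ∈_) (adjoints≡map (r ∷ rs)) x∈) =
      winsFirst-move Right (D + adjoint r′) (∈-options-+ˡ Right D (adjoint r′) r′∈)
                     (ih (Right , r′∈) (All.lookup dRs r′∈))

RightSeparates : Game → Game → Game → Set
RightSeparates K H T = winsFirst Right (K + T) ≡ true × winsFirst Right (H + T) ≡ false

⟨∣⟩-rightWins : ∀ K X → winsFirst Left (K + X) ≡ false → winsFirst Right (K + ⟨∣ X ⟩) ≡ true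
⟨∣⟩-rightWins K X =
  winsFirst-move Right (K + ⟨∣ X ⟩) (∈-options-+ʳ Right K ⟨∣ X ⟩ (here refl))

⟨∣⟩-rightSeparates : ∀ {K H X} → LeftDeadEnd H →
                     winsFirst Left (H + X) ≡ true → winsFirst Left (K + X) ≡ false →
                     RightSeparates K H ⟨∣ X ⟩
⟨∣⟩-rightSeparates {K} {H} {X} (lde dRs) H-wins K-loses =
  ⟨∣⟩-rightWins K X K-loses ,
  winsFirst-stuck Right (H + ⟨∣ X ⟩) (∈-options-+ʳ Right H ⟨∣ X ⟩ (here refl))
                  (All.tabulate leftWins)
  where
  leftWins : ∀ {y} → y ∈ options Right (H + ⟨∣ X ⟩) → winsFirst Left y ≡ true
  leftWins m with ∈-options-+⁻ Right H ⟨∣ X ⟩ m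
  ... | inj₁ (r , r∈ , refl)        = leftDeadEnd-+-leftWins (All.lookup dRs r∈) (X ∷ [])
  ... | inj₂ (_ , here refl , refl) = H-wins

separator : ∀ {K H} → LeftDeadEnd H → ¬ K ≥M H → ¬ ¬ ∃ (RightSeparates K H)
separator {K} {H} dH K≱H ¬separated = K≱H λ X → separate X (≥o-or-separated (K + X) (H + X))
  where
  separate : ∀ X → outcome (K + X) ≥o outcome (H + X)
                     ⊎ (winsFirst Left (H + X) ≡ true × winsFirst Left (K + X) ≡ false)
                     ⊎ RightSeparates K H X →
             outcome (K + X) ≥o outcome (H + X)
  separate X (inj₁ K≥H)                        = K≥H
  separate X (inj₂ (inj₁ (H-wins , K-loses))) =
    ⊥-elim (¬separated (⟨∣ X ⟩ , ⟨∣⟩-rightSeparates {K} dH H-wins K-loses))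
  separate X (inj₂ (inj₂ separates))          = ⊥-elim (¬separated (X , separates))

testGame : Game → List Game → Game
testGame K Ts = ⟨ ⟨∣ adjoint K ⟩ ∷ Ts ∣ ⟨ [] ∣ [] ⟩ ∷ [] ⟩

testGame-leftLoses : ∀ {K Ts} → LeftDeadEnd K → All (λ T → winsFirst Right (K + T) ≡ true) Ts →
                     winsFirst Left (K + testGame K Ts) ≡ false
testGame-leftLoses {K} {Ts} dK@(lde _) K-wins =
  winsFirst-stuck Left (K + testGame K Ts) (∈-options-+ʳ Left K (testGame K Ts) (here refl))
                  (All.tabulate rightWins)
  where
  rightWins : ∀ {y} → y ∈ options Left (K + testGame K Ts) → winsFirst Right y ≡ true
  rightWins m with ∈-options-+⁻ Left K (testGame K Ts) m
  ... | inj₁ (_ , () , _)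
  ... | inj₂ (_ , here refl , refl) = ⟨∣⟩-rightWins K (adjoint K) (adjoint-leftLoses K dK)
  ... | inj₂ (_ , there T∈ , refl)  = All.lookup K-wins T∈

testGame-rightLoses : ∀ {H K Ts} → LeftDeadEnd H →
                      All (λ h → Any (λ T → winsFirst Right (h + T) ≡ false) Ts) (rightOpts H) →
                      winsFirst Right (H + testGame K Ts) ≡ false
testGame-rightLoses {H} {K} {Ts} (lde _) H-loses =
  winsFirst-stuck Right (H + testGame K Ts) (∈-options-+ʳ Right H (testGame K Ts) (here refl))
                  (All.tabulate leftWins)
  where
  leftWins : ∀ {y} → y ∈ options Right (H + testGame K Ts) → winsFirst Left y ≡ true
  leftWins m with ∈-options-+⁻ Right H (testGame K Ts) m
  ... | inj₁ (h , h∈ , refl) with _ , T∈ , h-loses ← find (All.lookup H-loses h∈) =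
    winsFirst-move Left (h + testGame K Ts) (∈-options-+ʳ Left h (testGame K Ts) (there T∈)) h-loses
  ... | inj₂ (_ , here refl , refl) = refl

rightOption-dominates : ∀ {G H K} → LeftDeadEnd G → LeftDeadEnd H → G ≥M H → K ∈ rightOpts G →
                        ¬ ¬ Any (K ≥M_) (rightOpts H)
rightOption-dominates {G} {H} {K} (lde dGs) dH@(lde dHs) G≥H K∈ ¬dominates =
  ¬¬-All (All.tabulate λ h∈ → separator {K} (All.lookup dHs h∈) (¬dominates ∘ lose h∈))
  λ separations →
    let Ts               = All.reduce proj₁ separations
        X                = testGame K Ts
        covers , covered = witnesses-matches separations
        K-wins           = All.map (proj₁ ∘ proj₂ ∘ proj₂ ∘ find) covered
        G-wins           = winsFirst-move Right (G + X) (∈-options-+ˡ Right G X K∈)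
                                          (testGame-leftLoses (All.lookup dGs K∈) K-wins)
        H-loses          = testGame-rightLoses dH (All.map (Any.map proj₂) covers)
    in ¬≥o-rightFirst {G + X} {H + X} G-wins H-loses (G≥H X)

rightOption-equivalent : ∀ {G H g} → LeftDeadEnd G → LeftDeadEnd H → NoDominated G → G ≡M H →
                         g ∈ rightOpts G → ¬ ¬ Any (g ≡M_) (rightOpts H)
rightOption-equivalent {g = g} dG dH (nd _ _ undominated) (G≥H , H≥G) g∈ = do
  h  , h∈  , g≥h  ← ¬¬-map find (rightOption-dominates dG dH G≥H g∈)
  g′ , g′∈ , h≥g′ ← ¬¬-map find (rightOption-dominates dH dG H≥G h∈)
  g≅g′ ← (λ g≇g′ → undominated g∈ g′∈ g≇g′ (≥M-trans {g} {h} {g′} g≥h h≥g′))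
  pure (lose h∈ (g≥h , ≥M-trans {h} {g′} {g} h≥g′ (proj₂ (≅⇒≡M g≅g′))))

equivalent⇒¬¬≅ : ∀ G → LeftDeadEnd G → NoDominated G →
                 ∀ H → LeftDeadEnd H → NoDominated H → G ≡M H → ¬ ¬ (G ≅ H)
equivalent⇒¬¬≅ = game-induction Claim step
  where
  Claim : Game → Set
  Claim G = LeftDeadEnd G → NoDominated G →
            ∀ H → LeftDeadEnd H → NoDominated H → G ≡M H → ¬ ¬ (G ≅ H)

  step : ∀ G → (∀ {g} → g ⊏ G → Claim g) → Claim G
  step _ ih dG@(lde dGs) ndG@(nd _ ndGs _) _ dH@(lde dHs) ndH@(nd _ ndHs _) G≡H = do
    forth ← ¬¬-All (All.tabulate λ g∈ → do
      h , h∈ , g≡h ← ¬¬-map find (rightOption-equivalent dG dH ndG G≡H g∈)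
      ¬¬-map (lose h∈) (ih (Right , g∈) (All.lookup dGs g∈) (All.lookup ndGs g∈)
                                     h (All.lookup dHs h∈) (All.lookup ndHs h∈) g≡h))
    back ← ¬¬-All (All.tabulate λ {h} h∈ → do
      g , g∈ , h≡g ← ¬¬-map find (rightOption-equivalent dH dG ndH (swap G≡H) h∈)
      ¬¬-map (lose g∈) (ih (Right , g∈) (All.lookup dGs g∈) (All.lookup ndGs g∈)
                                     h (All.lookup dHs h∈) (All.lookup ndHs h∈) (swap h≡g)))
    pure (iso [] [] forth back)

theorem3p7 : (G H : Game) → LeftDeadEnd G → LeftDeadEnd H →
             NoDominated G → NoDominated H → G ≡M H → G ≅ H
theorem3p7 G H dG dH ndG ndH G≡H =
  decidable-stable (≅-dec G H) (equivalent⇒¬¬≅ G dG ndG H dH ndH G≡H)
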